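{- Let $n\geq 1$ and let $S\subseteq S_n$. Let $S'=\{\overline{s} : s\in S\}\subseteq A_{n+1}$, and let $\mathscr C$ be the union of all conjugacy classes of the symmetric group on $\{0,1,\ldots,n\}$ that intersect $S'$. Then for every $\pi\in S_n$ and every factorisation $\pi=g_t\circ g_{t-1}\circ\cdots\circ g_1$ with $g_1,\ldots,g_t\in S$, there exist $h_1,\ldots,h_t\in\mathscr C$ with $\overline{\pi}=h_t\circ h_{t-1}\circ\cdots\circ h_1$.
   Context: Permutations are composed from right to left. A permutation $\pi$ of $\{1,\ldots,n\}$ is written in one-line notation $\langle \pi_1\ \pi_2\ \cdots\ \pi_n\rangle$ with $\pi_i=\pi(i)$, and is identified with the permutation of $\{0,1,\ldots,n\}$ that fixes $0$ (so $\pi_0=0$). For $\pi\in S_n$, define $\overline{\pi}=(0,1,2,\ldots,n)\circ(0,\pi_n,\pi_{n-1},\ldots,\pi_1)$, a permutation of $\{0,1,\ldots,n\}$ (written in disjoint cycle notation); it is an even permutation, and $A_{n+1}$ denotes the group of even permutations of $\{0,1,\ldots,n\}$. -}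

module Defs where

open import Data.Nat using (ℕ; zero; suc; _+_)
open import Data.Nat.DivMod using (_mod_)
open import Data.Fin using (Fin; toℕ)
open import Data.Fin.Permutation using (Permutation′; _⟨$⟩ʳ_; _⟨$⟩ˡ_; lift₀)
open import Data.List using (List; []; _∷_)
open import Data.Product using (Σ; _×_)
open import Relation.Binary.PropositionalEquality using (_≡_)

-- Permutations of {0,…,n} are Permutation′ (suc n) on Fin (suc n);
-- an element π of S_n is a Permutation′ n, viewed on {0,…,n} via lift₀
-- (fixing 0, shifting i ↦ i+1 in Fin, so Fin-index i of lift₀ π stands for point i).

rot : (n : ℕ) → Fin (suc n) → Fin (suc n)
rot n i = suc (toℕ i) mod suc n

rotInv : (n : ℕ) → Fin (suc n) → Fin (suc n)
rotInv n i = (toℕ i + n) mod suc n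

-- the cycle (0, π_n, π_{n-1}, …, π_1): sends π_i to π_{i-1} (indices mod n+1, π_0 = 0)
cycleOf : {n : ℕ} → Permutation′ n → Fin (suc n) → Fin (suc n)
cycleOf {n} π x = lift₀ π ⟨$⟩ʳ rotInv n (lift₀ π ⟨$⟩ˡ x)

bar : {n : ℕ} → Permutation′ n → Fin (suc n) → Fin (suc n)
bar {n} π x = rot n (cycleOf π x)

-- product of a list [g₁,…,g_t] as g_t ∘ ⋯ ∘ g₁ (apply g₁ first)
applyAll : {m : ℕ} → List (Permutation′ m) → Fin m → Fin m
applyAll []       x = x
applyAll (g ∷ gs) x = applyAll gs (g ⟨$⟩ʳ x)

InC : {n : ℕ} → (Permutation′ n → Set) → Permutation′ (suc n) → Set
InC {n} S h = Σ (Permutation′ (suc n)) λ σ → Σ (Permutation′ n) λ s →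
  S s × ((x : Fin (suc n)) → h ⟨$⟩ʳ x ≡ σ ⟨$⟩ʳ bar s (σ ⟨$⟩ˡ x))

-- Write π̄ = R ∘ L_π ∘ R⁻¹ ∘ L_π⁻¹, where R = (0,1,…,n) and L_π is π acting on
-- {0,…,n} with 0 fixed; indeed (0,π_n,…,π_1) = L_π ∘ R⁻¹ ∘ L_π⁻¹.  Telescoping
-- gives the cocycle identity  (ρ ∘ g)‾ = ρ̄ ∘ (L_ρ ∘ ḡ ∘ L_ρ⁻¹),  so a
-- factorisation π = g_t ∘ ⋯ ∘ g₁ yields π̄ = h_t ∘ ⋯ ∘ h₁ with h_k the conjugate of
-- ḡ_k by L_{g_t ∘ ⋯ ∘ g_{k+1}}.
module Submission where

open import Defs
open import Data.Nat using (ℕ; suc; _≤_; _+_; _%_)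
open import Data.Nat.Properties using (+-comm; +-assoc; +-suc)
open import Data.Nat.DivMod using (%-distribˡ-+; m%n%n≡m%n; [m+n]%n≡m%n; m<n⇒m%n≡m; m%n<n)
open import Data.Fin using (Fin; toℕ) renaming (zero to 0F; suc to 1+)
open import Data.Fin.Properties using (toℕ-fromℕ<; toℕ-injective; toℕ<n)
open import Data.Fin.Permutation
  using (Permutation; Permutation′; _⟨$⟩ʳ_; _⟨$⟩ˡ_; _≈_; lift₀; permutation; id; flip; _∘ₚ_;
         inverseˡ; inverseʳ; lift₀-id; lift₀-comp; lift₀-cong)
open import Data.List using (List; length; []; _∷_)
open import Data.List.Relation.Unary.All using (All; []; _∷_)
open import Data.Product using (Σ; _×_; _,_)
open import Relation.Binary.PropositionalEquality using (_≡_; refl; sym; trans; cong)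
open Relation.Binary.PropositionalEquality.≡-Reasoning

[m%d+n]%d≡[m+n]%d : ∀ m n d → (m % suc d + n) % suc d ≡ (m + n) % suc d
[m%d+n]%d≡[m+n]%d m n d = begin
  (m % suc d + n) % suc d              ≡⟨ %-distribˡ-+ (m % suc d) n (suc d) ⟩
  (m % suc d % suc d + n % suc d) % suc d ≡⟨ cong (λ k → (k + n % suc d) % suc d) (m%n%n≡m%n m (suc d)) ⟩
  (m % suc d + n % suc d) % suc d      ≡⟨ sym (%-distribˡ-+ m n (suc d)) ⟩
  (m + n) % suc d                      ∎

[i+n]%n≡i : ∀ n (i : Fin (suc n)) → (toℕ i + suc n) % suc n ≡ toℕ i
[i+n]%n≡i n i = trans ([m+n]%n≡m%n (toℕ i) (suc n)) (m<n⇒m%n≡m (toℕ<n i))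

rot∘rotInv : ∀ n (i : Fin (suc n)) → rot n (rotInv n i) ≡ i
rot∘rotInv n i = toℕ-injective (begin
  toℕ (rot n (rotInv n i))          ≡⟨ toℕ-fromℕ< _ ⟩
  suc (toℕ (rotInv n i)) % suc n    ≡⟨ cong (λ k → suc k % suc n) (toℕ-fromℕ< _) ⟩
  suc ((toℕ i + n) % suc n) % suc n ≡⟨ cong (_% suc n) (+-comm 1 ((toℕ i + n) % suc n)) ⟩
  ((toℕ i + n) % suc n + 1) % suc n ≡⟨ [m%d+n]%d≡[m+n]%d (toℕ i + n) 1 n ⟩
  (toℕ i + n + 1) % suc n           ≡⟨ cong (_% suc n) (trans (+-assoc (toℕ i) n 1) (cong (toℕ i +_) (+-comm n 1))) ⟩
  (toℕ i + suc n) % suc n           ≡⟨ [i+n]%n≡i n i ⟩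
  toℕ i                             ∎)

rotInv∘rot : ∀ n (i : Fin (suc n)) → rotInv n (rot n i) ≡ i
rotInv∘rot n i = toℕ-injective (begin
  toℕ (rotInv n (rot n i))          ≡⟨ toℕ-fromℕ< _ ⟩
  (toℕ (rot n i) + n) % suc n       ≡⟨ cong (λ k → (k + n) % suc n) (toℕ-fromℕ< (m%n<n (suc (toℕ i)) (suc n))) ⟩
  (suc (toℕ i) % suc n + n) % suc n ≡⟨ [m%d+n]%d≡[m+n]%d (suc (toℕ i)) n n ⟩
  (suc (toℕ i) + n) % suc n         ≡⟨ cong (_% suc n) (sym (+-suc (toℕ i) n)) ⟩
  (toℕ i + suc n) % suc n           ≡⟨ [i+n]%n≡i n i ⟩
  toℕ i                             ∎)

rotation : (n : ℕ) → Permutation′ (suc n)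
rotation n = permutation (rot n) (rotInv n) (rot∘rotInv n) (rotInv∘rot n)

-- _∘ₚ_ is diagrammatic: (σ ∘ₚ τ) ⟨$⟩ʳ x = τ ⟨$⟩ʳ (σ ⟨$⟩ʳ x).
barₚ : {n : ℕ} → Permutation′ n → Permutation′ (suc n)
barₚ {n} g = flip (lift₀ g) ∘ₚ flip (rotation n) ∘ₚ lift₀ g ∘ₚ rotation n

conjugate : {m : ℕ} → Permutation′ m → Permutation′ m → Permutation′ m
conjugate σ h = flip σ ∘ₚ h ∘ₚ σ

conjugate-bar∈C : {n : ℕ} {S : Permutation′ n → Set} (σ : Permutation′ (suc n)) {s : Permutation′ n} →
                  S s → InC S (conjugate σ (barₚ s))
conjugate-bar∈C σ {s} Ss = σ , s , Ss , λ _ → refl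

product : {m : ℕ} → List (Permutation′ m) → Permutation′ m
product []       = id
product (g ∷ gs) = g ∘ₚ product gs

applyAll≡product : {m : ℕ} (gs : List (Permutation′ m)) (x : Fin m) → applyAll gs x ≡ product gs ⟨$⟩ʳ x
applyAll≡product []       x = refl
applyAll≡product (g ∷ gs) x = applyAll≡product gs (g ⟨$⟩ʳ x)

⟨$⟩ˡ-cong : {m n : ℕ} (π ρ : Permutation m n) → π ≈ ρ → ∀ y → π ⟨$⟩ˡ y ≡ ρ ⟨$⟩ˡ y
⟨$⟩ˡ-cong π ρ π≈ρ y = begin
  π ⟨$⟩ˡ y                      ≡⟨ sym (inverseˡ ρ) ⟩
  ρ ⟨$⟩ˡ (ρ ⟨$⟩ʳ (π ⟨$⟩ˡ y))    ≡⟨ cong (ρ ⟨$⟩ˡ_) (sym (π≈ρ _)) ⟩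
  ρ ⟨$⟩ˡ (π ⟨$⟩ʳ (π ⟨$⟩ˡ y))    ≡⟨ cong (ρ ⟨$⟩ˡ_) (inverseʳ π) ⟩
  ρ ⟨$⟩ˡ y                      ∎

lift₀-comp-inverse : {n : ℕ} (π ρ : Permutation′ n) (x : Fin (suc n)) →
                     lift₀ (π ∘ₚ ρ) ⟨$⟩ˡ x ≡ lift₀ π ⟨$⟩ˡ (lift₀ ρ ⟨$⟩ˡ x)
lift₀-comp-inverse π ρ 0F     = refl
lift₀-comp-inverse π ρ (1+ x) = refl

bar-cong : {n : ℕ} (ρ π : Permutation′ n) → ρ ≈ π → ∀ x → bar ρ x ≡ bar π x
bar-cong {n} ρ π ρ≈π x = begin
  rot n (lift₀ ρ ⟨$⟩ʳ rotInv n (lift₀ ρ ⟨$⟩ˡ x)) ≡⟨ cong (rot n) (lift₀-cong ρ π ρ≈π _) ⟩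
  rot n (lift₀ π ⟨$⟩ʳ rotInv n (lift₀ ρ ⟨$⟩ˡ x)) ≡⟨ cong (λ y → rot n (lift₀ π ⟨$⟩ʳ rotInv n y)) (⟨$⟩ˡ-cong (lift₀ ρ) (lift₀ π) (lift₀-cong ρ π ρ≈π) x) ⟩
  rot n (lift₀ π ⟨$⟩ʳ rotInv n (lift₀ π ⟨$⟩ˡ x)) ∎

bar-id : {n : ℕ} (x : Fin (suc n)) → bar (id {n}) x ≡ x
bar-id {n} x = begin
  rot n (lift₀ id ⟨$⟩ʳ rotInv n (lift₀ id ⟨$⟩ˡ x)) ≡⟨ cong (λ y → rot n (lift₀ id ⟨$⟩ʳ rotInv n y)) (⟨$⟩ˡ-cong (lift₀ id) id lift₀-id x) ⟩
  rot n (lift₀ id ⟨$⟩ʳ rotInv n x)                ≡⟨ cong (rot n) (lift₀-id (rotInv n x)) ⟩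
  rot n (rotInv n x)                              ≡⟨ rot∘rotInv n x ⟩
  x                                               ∎

bar-cocycle : {n : ℕ} (g ρ : Permutation′ n) (x : Fin (suc n)) →
              bar ρ (conjugate (lift₀ ρ) (barₚ g) ⟨$⟩ʳ x) ≡ bar (g ∘ₚ ρ) x
bar-cocycle {n} g ρ x = begin
  R (Lρ ⟨$⟩ʳ R⁻¹ (Lρ ⟨$⟩ˡ (Lρ ⟨$⟩ʳ R (Lg ⟨$⟩ʳ R⁻¹ (Lg ⟨$⟩ˡ (Lρ ⟨$⟩ˡ x))))))
    ≡⟨ cong (λ y → R (Lρ ⟨$⟩ʳ R⁻¹ y)) (inverseˡ Lρ {R (Lg ⟨$⟩ʳ R⁻¹ (Lg ⟨$⟩ˡ (Lρ ⟨$⟩ˡ x)))}) ⟩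
  R (Lρ ⟨$⟩ʳ R⁻¹ (R (Lg ⟨$⟩ʳ R⁻¹ (Lg ⟨$⟩ˡ (Lρ ⟨$⟩ˡ x)))))
    ≡⟨ cong (λ y → R (Lρ ⟨$⟩ʳ y)) (rotInv∘rot n _) ⟩
  R (Lρ ⟨$⟩ʳ (Lg ⟨$⟩ʳ R⁻¹ (Lg ⟨$⟩ˡ (Lρ ⟨$⟩ˡ x))))
    ≡⟨ cong R (lift₀-comp g ρ _) ⟩
  R (lift₀ (g ∘ₚ ρ) ⟨$⟩ʳ R⁻¹ (Lg ⟨$⟩ˡ (Lρ ⟨$⟩ˡ x)))
    ≡⟨ cong (λ y → R (lift₀ (g ∘ₚ ρ) ⟨$⟩ʳ R⁻¹ y)) (sym (lift₀-comp-inverse g ρ x)) ⟩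
  R (lift₀ (g ∘ₚ ρ) ⟨$⟩ʳ R⁻¹ (lift₀ (g ∘ₚ ρ) ⟨$⟩ˡ x)) ∎
  where
  R = rot n
  R⁻¹ = rotInv n
  Lg = lift₀ g
  Lρ = lift₀ ρ

bar-product-factorisation :
  {n : ℕ} (S : Permutation′ n → Set) (gs : List (Permutation′ n)) → All S gs →
  Σ (List (Permutation′ (suc n))) λ hs →
    length hs ≡ length gs × All (InC S) hs × ((x : Fin (suc n)) → applyAll hs x ≡ bar (product gs) x)
bar-product-factorisation S [] [] = [] , refl , [] , λ x → sym (bar-id x)
bar-product-factorisation S (g ∷ gs) (Sg ∷ Sgs) with bar-product-factorisation S gs Sgs
... | hs , |hs|≡|gs| , hs∈C , hs≡bar =
  h ∷ hs , cong suc |hs|≡|gs| , conjugate-bar∈C (lift₀ (product gs)) Sg ∷ hs∈C ,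
  λ x → trans (hs≡bar (h ⟨$⟩ʳ x)) (bar-cocycle g (product gs) x)
  where
  h = conjugate (lift₀ (product gs)) (barₚ g)

theorem1 : (n : ℕ) → 1 ≤ n → (S : Permutation′ n → Set) → (π : Permutation′ n)
    → (gs : List (Permutation′ n)) → All S gs
    → ((x : Fin n) → applyAll gs x ≡ π ⟨$⟩ʳ x)
    → Σ (List (Permutation′ (suc n))) λ hs →
    length hs ≡ length gs × All (InC S) hs
    × ((x : Fin (suc n)) → applyAll hs x ≡ bar π x)
theorem1 n _ S π gs Sgs gs≡π with bar-product-factorisation S gs Sgs
... | hs , |hs|≡|gs| , hs∈C , hs≡bar =
  hs , |hs|≡|gs| , hs∈C ,
  λ x → trans (hs≡bar x) (bar-cong (product gs) π (λ y → trans (sym (applyAll≡product gs y)) (gs≡π y)) x)
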